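{- Let $n\ge 4$ be an integer. If a graph $G$ has no induced subgraph isomorphic to $P_n$ or to $K_{\lceil n/2\rceil}\triangleright S_{\lceil n/2\rceil}$, then \[\chi(G)\le (n-3)^{\lceil n/2\rceil-1}\,\omega(G)^{\lceil n/2\rceil-1}.\]
   Context: $P_n$ is the path graph on $n$ vertices. For a positive integer $m$, $K_m\triangleright S_m$ denotes the graph on $2m$ vertices $a_1,\dots,a_m,b_1,\dots,b_m$ in which $\{a_1,\dots,a_m\}$ is a clique, $\{b_1,\dots,b_m\}$ is a stable set, and for all $1\le i,j\le m$, $a_i$ is adjacent to $b_j$ if and only if $i\ge j$. $\omega(G)$ is the clique number and $\chi(G)$ the chromatic number. -}

module Defs where

open import Data.Nat using (ℕ; zero; suc; _+_; _*_; _∸_; _^_; _≤_; _<_; _/_)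
open import Data.Nat.Properties using (_≤?_)
open import Data.Fin using (Fin; toℕ; splitAt)
open import Data.Fin.Properties using (_≟_)
open import Data.Bool using (Bool; true; false; not)
open import Data.Sum using (_⊎_; inj₁; inj₂)
open import Data.Product using (Σ; _×_; _,_; ∃)
open import Relation.Nullary using (¬_)
open import Relation.Nullary.Decidable using (⌊_⌋)
open import Relation.Binary.PropositionalEquality using (_≡_; _≢_)
open import Function.Definitions using (Injective)

record Graph (N : ℕ) : Set where
  field
    adj    : Fin N → Fin N → Bool
    sym    : ∀ i j → adj i j ≡ adj j i
    irrefl : ∀ i → adj i i ≡ false
open Graph public

HasInduced : ∀ {k N} → (Fin k → Fin k → Bool) → Graph N → Set
HasInduced {k} {N} h G =
  Σ (Fin k → Fin N) λ f → Injective _≡_ _≡_ f × (∀ i j → adj G (f i) (f j) ≡ h i j)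

diff1 : ℕ → ℕ → Bool
diff1 zero (suc zero) = true
diff1 (suc zero) zero = true
diff1 (suc a) (suc b) = diff1 a b
diff1 _ _ = false

pathAdj : (n : ℕ) → Fin n → Fin n → Bool
pathAdj n i j = diff1 (toℕ i) (toℕ j)

-- K_m ▷ S_m on Fin (m + m): the first m vertices are a_1..a_m (a clique),
-- the last m are b_1..b_m (a stable set); a_i ~ b_j iff i ≥ j.
KSAdj : (m : ℕ) → Fin (m + m) → Fin (m + m) → Bool
KSAdj m x y with splitAt m x | splitAt m y
... | inj₁ i | inj₁ j = not ⌊ i ≟ j ⌋
... | inj₂ _ | inj₂ _ = false
... | inj₁ i | inj₂ j = ⌊ toℕ j ≤? toℕ i ⌋
... | inj₂ j | inj₁ i = ⌊ toℕ j ≤? toℕ i ⌋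

IsClique : ∀ {N k} → Graph N → (Fin k → Fin N) → Set
IsClique G f = Injective _≡_ _≡_ f × (∀ i j → i ≢ j → adj G (f i) (f j) ≡ true)

HasClique : ∀ {N} → Graph N → ℕ → Set
HasClique {N} G k = Σ (Fin k → Fin N) (IsClique G)

IsCliqueNumber : ∀ {N} → Graph N → ℕ → Set
IsCliqueNumber G w = HasClique G w × (∀ k → w < k → ¬ HasClique G k)

ProperColouring : ∀ {N} → Graph N → (c : ℕ) → (Fin N → Fin c) → Set
ProperColouring G c col = ∀ i j → adj G i j ≡ true → col i ≢ col j

ChromaticAtMost : ∀ {N} → Graph N → ℕ → Set
ChromaticAtMost {N} G c = Σ (Fin N → Fin c) (ProperColouring G c)

ceilHalf : ℕ → ℕ
ceilHalf n = (n + 1) / 2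

module Submission where

-- Write a = n - 3 and bound a s w = a^s · w^s.  By induction on (s, w),
-- lexicographically, every vertex set S with no induced K_{s+1} ▷ S_{s+1}
-- and no clique of size w + 1 is coloured with bound a s w colours.  For
-- s = 0 the set S has no edge; for w = 0 it is empty.  Otherwise S is
-- coloured one connected component K at a time; in the component of v:
--  * the neighbours of v have no clique of size w + 1, giving bound a (s+1) w;
--  * the other vertices are reached along induced paths starting at v
--    (Gyárfás' path argument).  Growing an induced path q with tip t and
--    previous vertex t′, the vertices ahead of q that are adjacent to t form
--    a set hanging below the edge t t′: it has no K_s ▷ S_s, since adding t
--    and t′ would create a K_{s+1} ▷ S_{s+1}, so it takes bound a s (w+1)
--    colours; the remaining vertices are handled by extending q, and without
--    induced P_n there are at most n - 3 extensions, giving a · bound a s (w+1).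
-- Finally bound a (s+1) w + a · bound a s (w+1) ≤ bound a (s+1) (w+1).

open import Defs hiding (sym)
open import Data.Nat using (ℕ; zero; suc; _+_; _*_; _∸_; _^_; _≤_; _<_; z≤n; s≤s)
open import Data.Nat.Properties
  using (_≤?_; ≤-refl; ≤-trans; <⇒≢; <⇒≱; <⇒≤; n≤1+n; m≤n⇒m≤1+n; m≤m+n; m≤n+m; ≤-pred;
         +-monoʳ-<; +-monoˡ-≤; +-cancelˡ-≡; +-suc; +-comm; *-assoc; *-mono-≤;
         *-monoʳ-≤; *-distribˡ-+; ^-monoˡ-≤; m^n>0; m∸n+n≡m; m+[n∸m]≡n; ∸-monoˡ-≤; module ≤-Reasoning)
open import Data.Nat.DivMod using (m≥n⇒m/n>0)
open import Data.Bool using (Bool; true; false; not; _∧_; _∨_; if_then_else_)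
open import Data.Bool.Properties using (∧-conicalˡ; ∧-conicalʳ; ∨-conicalˡ; ∨-conicalʳ; ∧-zeroʳ; not-injective)
open import Data.Fin using (Fin; zero; suc; toℕ; splitAt; join; _↑ˡ_; _↑ʳ_; fromℕ; inject₁; fromℕ<)
open import Data.Fin.Properties
  using (_≟_; splitAt-↑ˡ; splitAt-↑ʳ; join-splitAt; ↑ˡ-injective; ↑ʳ-injective; toℕ-↑ˡ; toℕ-↑ʳ;
         toℕ<n; fromℕ≢inject₁; inject₁-injective; toℕ-inject₁; toℕ-fromℕ; toℕ-fromℕ<)
open import Data.Vec.Functional using (Vector; _∷_; []; head)
open import Data.Maybe using (Maybe; just; nothing; map)
open import Data.Sum using (_⊎_; inj₁; inj₂)
open import Data.Product using (Σ; _×_; _,_; proj₁; proj₂; ∃)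
open import Data.Empty using (⊥; ⊥-elim)
open import Relation.Nullary using (¬_; Dec; yes; no)
open import Relation.Nullary.Decidable using (⌊_⌋)
open import Relation.Binary.PropositionalEquality using (_≡_; _≢_; refl; sym; trans; cong; subst; subst₂)
open import Function using (_∘_)
open import Function.Definitions using (Injective)

bool-clash : ∀ {b} → b ≡ true → b ≡ false → ⊥
bool-clash refl ()

bool-ext : ∀ {b c} → (b ≡ true → c ≡ true) → (c ≡ true → b ≡ true) → b ≡ c
bool-ext {true}  b⇒c _ = sym (b⇒c refl)
bool-ext {false} {true}  _ c⇒b = c⇒b refl
bool-ext {false} {false} _ _ = refl

∨-elim : ∀ {b c} → b ∨ c ≡ true → b ≡ true ⊎ c ≡ true
∨-elim {true}  _ = inj₁ refl
∨-elim {false} e = inj₂ e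

isYes-true : ∀ {P : Set} (d : Dec P) → P → ⌊ d ⌋ ≡ true
isYes-true (yes _) _ = refl
isYes-true (no ¬p) p = ⊥-elim (¬p p)

isYes-false : ∀ {P : Set} (d : Dec P) → ¬ P → ⌊ d ⌋ ≡ false
isYes-false (yes p) ¬p = ⊥-elim (¬p p)
isYes-false (no _)  _  = refl

isYes-sound : ∀ {P : Set} (d : Dec P) → ⌊ d ⌋ ≡ true → P
isYes-sound (yes p) _ = p

-- Vertex sets of a graph on Fin N are Boolean predicates, so that sets can be
-- computed (neighbourhoods, components) and membership is decidable.

VSet : ℕ → Set
VSet N = Fin N → Bool

module _ {N : ℕ} where

  infix 4 _∈_ _∉_ _⊆_
  infixl 6 _∩_ _∖_ _∪_

  _∈_ _∉_ : Fin N → VSet N → Set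
  x ∈ S = S x ≡ true
  x ∉ S = S x ≡ false

  _⊆_ : VSet N → VSet N → Set
  S ⊆ T = ∀ x → x ∈ S → x ∈ T

  -- The set operations are opaque so that Agda can infer the sets in the
  -- lemmas below from membership types.
  opaque
    _∩_ _∪_ _∖_ : VSet N → VSet N → VSet N
    (S ∩ T) x = S x ∧ T x
    (S ∪ T) x = S x ∨ T x
    (S ∖ T) x = S x ∧ not (T x)

    ⟦_⟧ : Fin N → VSet N
    ⟦ v ⟧ y = ⌊ v ≟ y ⌋

  everything : VSet N
  everything _ = true

  ∈-or-∉ : ∀ x (S : VSet N) → x ∈ S ⊎ x ∉ S
  ∈-or-∉ x S with S x
  ... | true  = inj₁ refl
  ... | false = inj₂ refl

  opaque
    unfolding _∩_ _∪_ _∖_ ⟦_⟧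

    ∩⁺ : ∀ {x} {S T : VSet N} → x ∈ S → x ∈ T → x ∈ S ∩ T
    ∩⁺ {x} {S} {T} x∈S x∈T = subst (λ b → b ∧ T x ≡ true) (sym x∈S) x∈T

    ∩⁻ˡ : ∀ {x} {S T : VSet N} → x ∈ S ∩ T → x ∈ S
    ∩⁻ˡ = ∧-conicalˡ _ _

    ∩⁻ʳ : ∀ {x} {S T : VSet N} → x ∈ S ∩ T → x ∈ T
    ∩⁻ʳ = ∧-conicalʳ _ _

    ∖⁺ : ∀ {x} {S T : VSet N} → x ∈ S → x ∉ T → x ∈ S ∖ T
    ∖⁺ x∈S x∉T = subst₂ (λ b c → b ∧ not c ≡ true) (sym x∈S) (sym x∉T) refl

    ∖⁻ˡ : ∀ {x} {S T : VSet N} → x ∈ S ∖ T → x ∈ S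
    ∖⁻ˡ = ∧-conicalˡ _ _

    ∖⁻ʳ : ∀ {x} {S T : VSet N} → x ∈ S ∖ T → x ∉ T
    ∖⁻ʳ x∈ = not-injective (∧-conicalʳ _ _ x∈)

    ∖-excludes : ∀ {x} {S T : VSet N} → x ∈ T → x ∉ S ∖ T
    ∖-excludes {x} {S} x∈T = subst (λ b → S x ∧ not b ≡ false) (sym x∈T) (∧-zeroʳ (S x))

    ∪⁺ˡ : ∀ {x} {S T : VSet N} → x ∈ S → x ∈ S ∪ T
    ∪⁺ˡ {x} {S} {T} x∈S = subst (λ b → b ∨ T x ≡ true) (sym x∈S) refl

    ∪⁺ʳ : ∀ {x} {S T : VSet N} → x ∈ T → x ∈ S ∪ T
    ∪⁺ʳ {x} {S} x∈T with S x
    ... | true  = refl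
    ... | false = x∈T

    ∪⁻ : ∀ {x} {S T : VSet N} → x ∈ S ∪ T → x ∈ S ⊎ x ∈ T
    ∪⁻ = ∨-elim

    ∉∪⁺ : ∀ {x} {S T : VSet N} → x ∉ S → x ∉ T → x ∉ S ∪ T
    ∉∪⁺ x∉S x∉T = subst₂ (λ b c → b ∨ c ≡ false) (sym x∉S) (sym x∉T) refl

    ∉∪⁻ : ∀ {x} {S T : VSet N} → x ∉ S ∪ T → x ∉ S × x ∉ T
    ∉∪⁻ x∉ = ∨-conicalˡ _ _ x∉ , ∨-conicalʳ _ _ x∉

    v∈⟦v⟧ : ∀ v → v ∈ ⟦ v ⟧
    v∈⟦v⟧ v = isYes-true (v ≟ v) refl

    ∈⟦⟧ : ∀ {v y} → y ∈ ⟦ v ⟧ → v ≡ y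
    ∈⟦⟧ {v} {y} = isYes-sound (v ≟ y)

    ∉⟦⟧⁺ : ∀ {v y} → v ≢ y → y ∉ ⟦ v ⟧
    ∉⟦⟧⁺ {v} {y} = isYes-false (v ≟ y)

  ∉⟦⟧⁻ : ∀ {v y} → y ∉ ⟦ v ⟧ → v ≢ y
  ∉⟦⟧⁻ y∉ refl = bool-clash (v∈⟦v⟧ _) y∉

exists : ∀ {m} → VSet m → Bool
exists {zero}  P = false
exists {suc m} P = P zero ∨ exists (P ∘ suc)

exists-intro : ∀ {m} (P : VSet m) i → i ∈ P → exists P ≡ true
exists-intro P zero    i∈P rewrite i∈P = refl
exists-intro P (suc i) i∈P with P zero
... | true  = refl
... | false = exists-intro (P ∘ suc) i i∈P

exists-witness : ∀ {m} (P : VSet m) → exists P ≡ true → ∃ λ i → i ∈ P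
exists-witness {suc m} P e with ∨-elim {P zero} e
... | inj₁ p0 = zero , p0
... | inj₂ ps with exists-witness (P ∘ suc) ps
...   | i , pi = suc i , pi

exists-none : ∀ {m} (P : VSet m) → exists P ≡ false → ∀ i → i ∉ P
exists-none P none i with ∈-or-∉ i P
... | inj₁ i∈P = ⊥-elim (bool-clash (exists-intro P i i∈P) none)
... | inj₂ i∉P = i∉P

witness-or-empty : ∀ {m} (P : VSet m) → (∃ λ i → i ∈ P) ⊎ (∀ i → ¬ i ∈ P)
witness-or-empty P with exists P in e
... | true  = inj₁ (exists-witness P e)
... | false = inj₂ λ i i∈P → bool-clash i∈P (exists-none P e i)

first : ∀ {m} → VSet m → Maybe (Fin m)
first {zero}  P = nothing
first {suc m} P = if P zero then just zero else map suc (first (P ∘ suc))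

first-sound : ∀ {m} (P : VSet m) {i} → first P ≡ just i → i ∈ P
first-sound {suc m} P e with P zero in p0
first-sound {suc m} P refl | true = p0
... | false with first (P ∘ suc) in e′
first-sound {suc m} P refl | false | just j = first-sound (P ∘ suc) e′

first-complete : ∀ {m} (P : VSet m) i → i ∈ P → ∃ λ j → first P ≡ just j
first-complete {suc m} P i i∈P with P zero in p0
... | true = zero , refl
first-complete {suc m} P zero    i∈P | false = ⊥-elim (bool-clash i∈P p0)
first-complete {suc m} P (suc i) i∈P | false with first-complete (P ∘ suc) i i∈P
... | j , e rewrite e = suc j , refl

first-cong : ∀ {m} {P Q : VSet m} → (∀ i → P i ≡ Q i) → first P ≡ first Q
first-cong {zero}          P≗Q = refl
first-cong {suc m} {P} {Q} P≗Q rewrite P≗Q zero | first-cong {P = P ∘ suc} {Q ∘ suc} (P≗Q ∘ suc) = refl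

count : ∀ {m} → VSet m → ℕ
count {zero}  P = 0
count {suc m} P = (if P zero then 1 else 0) + count (P ∘ suc)

count≤ : ∀ {m} (P : VSet m) → count P ≤ m
count≤ {zero}  P = z≤n
count≤ {suc m} P with P zero
... | true  = s≤s (count≤ (P ∘ suc))
... | false = m≤n⇒m≤1+n (count≤ (P ∘ suc))

count-pos : ∀ {m} (P : VSet m) i → i ∈ P → 0 < count P
count-pos P zero    i∈P rewrite i∈P = s≤s z≤n
count-pos P (suc i) i∈P = ≤-trans (count-pos (P ∘ suc) i i∈P) (m≤n+m _ _)

count-mono : ∀ {m} (P Q : VSet m) → P ⊆ Q → count P ≤ count Q
count-mono {zero}  P Q P⊆Q = z≤n
count-mono {suc m} P Q P⊆Q with P zero in p0 | Q zero in q0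
... | true  | true  = s≤s (count-mono (P ∘ suc) (Q ∘ suc) (P⊆Q ∘ suc))
... | true  | false = ⊥-elim (bool-clash (P⊆Q zero p0) q0)
... | false | true  = m≤n⇒m≤1+n (count-mono (P ∘ suc) (Q ∘ suc) (P⊆Q ∘ suc))
... | false | false = count-mono (P ∘ suc) (Q ∘ suc) (P⊆Q ∘ suc)

count-< : ∀ {m} (P Q : VSet m) → P ⊆ Q → ∀ i → i ∈ Q → i ∉ P → count P < count Q
count-< P Q P⊆Q zero i∈Q i∉P rewrite i∈Q | i∉P = s≤s (count-mono (P ∘ suc) (Q ∘ suc) (P⊆Q ∘ suc))
count-< P Q P⊆Q (suc i) i∈Q i∉P with P zero in p0 | Q zero in q0
... | true  | true  = s≤s (count-< (P ∘ suc) (Q ∘ suc) (P⊆Q ∘ suc) i i∈Q i∉P)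
... | true  | false = ⊥-elim (bool-clash (P⊆Q zero p0) q0)
... | false | true  = s≤s (<⇒≤ (count-< (P ∘ suc) (Q ∘ suc) (P⊆Q ∘ suc) i i∈Q i∉P))
... | false | false = count-< (P ∘ suc) (Q ∘ suc) (P⊆Q ∘ suc) i i∈Q i∉P

KSAdj-clique : ∀ m (i j : Fin m) → KSAdj m (i ↑ˡ m) (j ↑ˡ m) ≡ not ⌊ i ≟ j ⌋
KSAdj-clique m i j rewrite splitAt-↑ˡ m i m | splitAt-↑ˡ m j m = refl

KSAdj-cross : ∀ m (i j : Fin m) → KSAdj m (i ↑ˡ m) (m ↑ʳ j) ≡ ⌊ toℕ j ≤? toℕ i ⌋
KSAdj-cross m i j rewrite splitAt-↑ˡ m i m | splitAt-↑ʳ m m j = refl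

KSAdj-stable : ∀ m (i j : Fin m) → KSAdj m (m ↑ʳ i) (m ↑ʳ j) ≡ false
KSAdj-stable m i j rewrite splitAt-↑ʳ m m i | splitAt-↑ʳ m m j = refl

data LastOrOld : ∀ {s} → Fin (suc s) → Set where
  last : ∀ {s} → LastOrOld (fromℕ s)
  old  : ∀ {s} (i : Fin s) → LastOrOld (inject₁ i)

lastOrOld : ∀ {s} (i : Fin (suc s)) → LastOrOld i
lastOrOld {zero}  zero = last
lastOrOld {suc s} zero = old zero
lastOrOld {suc s} (suc i) with lastOrOld i
... | last  = last
... | old j = old (suc j)

diff1-suc : ∀ a b → diff1 (suc a) (suc b) ≡ diff1 a b
diff1-suc zero          zero          = refl
diff1-suc zero          (suc zero)    = refl
diff1-suc zero          (suc (suc b)) = refl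
diff1-suc (suc zero)    zero          = refl
diff1-suc (suc (suc a)) zero          = refl
diff1-suc (suc a)       (suc b)       = refl

bound : ℕ → ℕ → ℕ → ℕ
bound a s w = a ^ s * w ^ s

-- The inequality that closes the induction:
--   a^(s+1) w^(s+1) + a · a^s (w+1)^s ≤ a^(s+1) (w+1)^(s+1),  as w^s ≤ (w+1)^s.
bound-step : ∀ a s w → bound a (suc s) w + a * bound a s (suc w) ≤ bound a (suc s) (suc w)
bound-step a s w = begin
    P * (w * X) + a * (a ^ s * Y) ≡⟨ cong (P * (w * X) +_) (sym (*-assoc a (a ^ s) Y)) ⟩
    P * (w * X) + P * Y           ≤⟨ +-monoˡ-≤ (P * Y) (*-monoʳ-≤ P (*-monoʳ-≤ w (^-monoˡ-≤ s (n≤1+n w)))) ⟩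
    P * (w * Y) + P * Y           ≡⟨ +-comm (P * (w * Y)) (P * Y) ⟩
    P * Y + P * (w * Y)           ≡⟨ sym (*-distribˡ-+ P Y (w * Y)) ⟩
    P * (Y + w * Y)               ∎
  where
  open ≤-Reasoning
  P X Y : ℕ
  P = a * a ^ s
  X = w ^ s
  Y = suc w ^ s

bound-pos : ∀ {a} s w → 1 ≤ a → 1 ≤ a * bound a s (suc w)
bound-pos {suc a} s w _ = ≤-trans (*-mono-≤ (m^n>0 (suc a) s) (m^n>0 (suc w) s)) (m≤m+n _ _)

module _ {N : ℕ} (G : Graph N) where

  private
    A : Fin N → VSet N
    A = adj G

  adj-sym : ∀ {x y} → y ∈ A x → x ∈ A y
  adj-sym {x} {y} xy = trans (Graph.sym G y x) xy

  adjacent⇒distinct : ∀ {x y} → y ∈ A x → x ≢ y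
  adjacent⇒distinct {x} xx refl = bool-clash xx (Graph.irrefl G x)

  separated-by : ∀ {x u y} → u ∈ A x → y ∉ A x → y ∉ ⟦ u ⟧
  separated-by {x} u∈Ax y∉Ax = ∉⟦⟧⁺ λ u≡y → bool-clash (subst (λ z → z ∈ A x) u≡y u∈Ax) y∉Ax

  Anticomplete : VSet N → VSet N → Set
  Anticomplete X Y = ∀ x y → x ∈ X → y ∈ Y → y ∈ A x → ⊥

  record Colouring (S : VSet N) (c : ℕ) : Set where
    constructor colouring
    field
      colour  : Fin N → ℕ
      bounded : ∀ x → x ∈ S → colour x < c
      proper  : ∀ x y → x ∈ S → y ∈ S → y ∈ A x → colour x ≢ colour y
  open Colouring

  colour-restrict : ∀ {S T c} → T ⊆ S → Colouring S c → Colouring T c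
  colour-restrict T⊆S χ = colouring (colour χ) (λ x x∈T → bounded χ x (T⊆S x x∈T))
    (λ x y x∈T y∈T → proper χ x y (T⊆S x x∈T) (T⊆S y y∈T))

  colour-weaken : ∀ {S c c′} → c ≤ c′ → Colouring S c → Colouring S c′
  colour-weaken c≤c′ χ = colouring (colour χ) (λ x x∈S → ≤-trans (bounded χ x x∈S) c≤c′) (proper χ)

  colour-empty : ∀ {S c} → (∀ x → ¬ x ∈ S) → Colouring S c
  colour-empty empty = colouring (λ _ → 0) (λ x x∈S → ⊥-elim (empty x x∈S)) (λ x _ x∈S → ⊥-elim (empty x x∈S))

  colour-singleton : ∀ {c} v → 1 ≤ c → Colouring ⟦ v ⟧ c
  colour-singleton v 1≤c = colouring (λ _ → 0) (λ _ _ → 1≤c)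
    λ x y x∈ y∈ xy _ → adjacent⇒distinct xy (trans (sym (∈⟦⟧ x∈)) (∈⟦⟧ y∈))

  colour-split : ∀ {S} P {c₁ c₂} → Colouring (S ∩ P) c₁ → Colouring (S ∖ P) c₂ → Colouring S (c₁ + c₂)
  colour-split {S} P {c₁} {c₂} χ₁ χ₂ = colouring col bnd prp
    where
    col : Fin N → ℕ
    col x = if P x then colour χ₁ x else c₁ + colour χ₂ x
    low : ∀ {x} → x ∈ S → x ∈ P → ∀ k → colour χ₁ x < c₁ + k
    low {x} x∈S x∈P k = ≤-trans (bounded χ₁ x (∩⁺ x∈S x∈P)) (m≤m+n c₁ k)
    bnd : ∀ x → x ∈ S → col x < c₁ + c₂
    bnd x x∈S with P x in x∈P
    ... | true  = low x∈S x∈P c₂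
    ... | false = +-monoʳ-< c₁ (bounded χ₂ x (∖⁺ x∈S x∈P))
    prp : ∀ x y → x ∈ S → y ∈ S → y ∈ A x → col x ≢ col y
    prp x y x∈S y∈S xy with P x in x∈P | P y in y∈P
    ... | true  | true  = proper χ₁ x y (∩⁺ x∈S x∈P) (∩⁺ y∈S y∈P) xy
    ... | true  | false = <⇒≢ (low x∈S x∈P (colour χ₂ y))
    ... | false | true  = λ e → <⇒≢ (low y∈S y∈P (colour χ₂ x)) (sym e)
    ... | false | false = λ e → proper χ₂ x y (∖⁺ x∈S x∈P) (∖⁺ y∈S y∈P) xy (+-cancelˡ-≡ c₁ _ _ e)

  colour-glue : ∀ {S} P {c} → Anticomplete (S ∩ P) (S ∖ P) → Colouring (S ∩ P) c → Colouring (S ∖ P) c → Colouring S c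
  colour-glue {S} P {c} apart χ₁ χ₂ = colouring col bnd prp
    where
    col : Fin N → ℕ
    col x = if P x then colour χ₁ x else colour χ₂ x
    bnd : ∀ x → x ∈ S → col x < c
    bnd x x∈S with P x in x∈P
    ... | true  = bounded χ₁ x (∩⁺ x∈S x∈P)
    ... | false = bounded χ₂ x (∖⁺ x∈S x∈P)
    prp : ∀ x y → x ∈ S → y ∈ S → y ∈ A x → col x ≢ col y
    prp x y x∈S y∈S xy with P x in x∈P | P y in y∈P
    ... | true  | true  = proper χ₁ x y (∩⁺ x∈S x∈P) (∩⁺ y∈S y∈P) xy
    ... | true  | false = ⊥-elim (apart x y (∩⁺ x∈S x∈P) (∖⁺ y∈S y∈P) xy)
    ... | false | true  = ⊥-elim (apart y x (∩⁺ y∈S y∈P) (∖⁺ x∈S x∈P) (adj-sym xy))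
    ... | false | false = proper χ₂ x y (∖⁺ x∈S x∈P) (∖⁺ y∈S y∈P) xy

  chromatic-from-colouring : ∀ {c} → Colouring everything c → ChromaticAtMost G c
  chromatic-from-colouring χ = (λ x → fromℕ< (bounded χ x refl)) ,
    λ x y xy e → proper χ x y refl refl xy
      (trans (sym (toℕ-fromℕ< (bounded χ x refl))) (trans (cong toℕ e) (toℕ-fromℕ< (bounded χ y refl))))

  colour-by-pieces : ∀ {S₀ c} →
    (∀ S → S ⊆ S₀ → ∀ v → v ∈ S →
       Σ (VSet N) λ K → v ∈ K × Anticomplete (S ∩ K) (S ∖ K) × Colouring (S ∩ K) c) →
    Colouring S₀ c
  colour-by-pieces {S₀} {c} piece = go (count S₀) S₀ ≤-refl (λ _ x∈ → x∈)
    where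
    go : ∀ b S → count S ≤ b → S ⊆ S₀ → Colouring S c
    go zero S size _ = colour-empty λ x x∈S → <⇒≱ (count-pos S x x∈S) size
    go (suc b) S size S⊆S₀ with witness-or-empty S
    ... | inj₂ empty = colour-empty empty
    ... | inj₁ (v , v∈S) with piece S S⊆S₀ v v∈S
    ...   | K , v∈K , apart , χ = colour-glue K apart χ (go b (S ∖ K) smaller (λ x x∈ → S⊆S₀ x (∖⁻ˡ x∈)))
      where
      smaller : count (S ∖ K) ≤ b
      smaller = ≤-pred (≤-trans (count-< (S ∖ K) S (λ _ → ∖⁻ˡ) v v∈S (∖-excludes v∈K)) size)

  -- Connected components, computed by saturation.

  nbhd : VSet N → VSet N
  nbhd R y = exists (R ∩ A y)

  nbhd⁺ : ∀ {R y z} → z ∈ R → y ∈ A z → y ∈ nbhd R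
  nbhd⁺ {R} {y} {z} z∈R zy = exists-intro (R ∩ A y) z (∩⁺ z∈R (adj-sym zy))

  nbhd⁻ : ∀ {R y} → y ∈ nbhd R → ∃ λ z → z ∈ R × y ∈ A z
  nbhd⁻ {R} {y} y∈ with exists-witness (R ∩ A y) y∈
  ... | z , z∈ = z , ∩⁻ˡ z∈ , adj-sym (∩⁻ʳ z∈)

  grow : VSet N → VSet N → VSet N
  grow S R = R ∪ (S ∩ nbhd R)

  ball : VSet N → Fin N → ℕ → VSet N
  ball S x zero    = ⟦ x ⟧
  ball S x (suc j) = grow S (ball S x j)

  -- reach S x: x together with the vertices of S joined to x by a path in S.
  reach : VSet N → Fin N → VSet N
  reach S x = ball S x N

  Closed : VSet N → VSet N → Set
  Closed S R = ∀ y z → y ∈ R → z ∈ S → z ∈ A y → z ∈ R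

  closed⇒grow-⊆ : ∀ {S R} → Closed S R → grow S R ⊆ R
  closed⇒grow-⊆ closed y y∈ with ∪⁻ y∈
  ... | inj₁ y∈R = y∈R
  ... | inj₂ new with nbhd⁻ (∩⁻ʳ new)
  ...   | z , z∈R , zy = closed z y z∈R (∩⁻ˡ new) zy

  grow-⊆⇒closed : ∀ {S R} → grow S R ⊆ R → Closed S R
  grow-⊆⇒closed stable y z y∈R z∈S yz = stable z (∪⁺ʳ (∩⁺ z∈S (nbhd⁺ y∈R yz)))

  grow-closed : ∀ {S R} → Closed S R → Closed S (grow S R)
  grow-closed closed y z y∈ z∈S yz = ∪⁺ˡ (closed y z (closed⇒grow-⊆ closed y y∈) z∈S yz)

  grow-or-closed : ∀ S R → Closed S R ⊎ count R < count (grow S R)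
  grow-or-closed S R with witness-or-empty (grow S R ∖ R)
  ... | inj₁ (y , new) = inj₂ (count-< R (grow S R) (λ _ → ∪⁺ˡ) y (∖⁻ˡ new) (∖⁻ʳ new))
  ... | inj₂ nothing-new = inj₁ (grow-⊆⇒closed stable)
    where
    stable : grow S R ⊆ R
    stable y y∈ with ∈-or-∉ y R
    ... | inj₁ y∈R = y∈R
    ... | inj₂ y∉R = ⊥-elim (nothing-new y (∖⁺ y∈ y∉R))

  ball-centre : ∀ S x j → x ∈ ball S x j
  ball-centre S x zero    = v∈⟦v⟧ x
  ball-centre S x (suc j) = ∪⁺ˡ (ball-centre S x j)

  ball-⊆ : ∀ {S x} j {y} → y ∈ ball S x j → x ≡ y ⊎ y ∈ S
  ball-⊆ zero    y∈ = inj₁ (∈⟦⟧ y∈)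
  ball-⊆ (suc j) y∈ with ∪⁻ y∈
  ... | inj₁ earlier = ball-⊆ j earlier
  ... | inj₂ new = inj₂ (∩⁻ˡ new)

  ball-closed-or-large : ∀ S x j → Closed S (ball S x j) ⊎ j < count (ball S x j)
  ball-closed-or-large S x zero = inj₂ (count-pos _ x (v∈⟦v⟧ x))
  ball-closed-or-large S x (suc j) with ball-closed-or-large S x j
  ... | inj₁ closed = inj₁ (grow-closed closed)
  ... | inj₂ large with grow-or-closed S (ball S x j)
  ...   | inj₁ closed = inj₁ (grow-closed closed)
  ...   | inj₂ more   = inj₂ (≤-trans (s≤s large) more)

  -- Since no set has more than N vertices, N rounds reach a closed set.
  reach-closed : ∀ S x → Closed S (reach S x)
  reach-closed S x with ball-closed-or-large S x N
  ... | inj₁ closed = closed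
  ... | inj₂ large  = ⊥-elim (<⇒≱ large (count≤ (reach S x)))

  record Embeds {k} (h : Fin k → Fin k → Bool) (S : VSet N) (f : Fin k → Fin N) : Set where
    constructor embedding
    field
      injective : Injective _≡_ _≡_ f
      inside    : ∀ i → f i ∈ S
      preserves : ∀ i j → A (f i) (f j) ≡ h i j
  open Embeds

  induced-in-G : ∀ {k} {h : Fin k → Fin k → Bool} {S f} → Embeds h S f → HasInduced h G
  induced-in-G {f = f} e = f , injective e , preserves e

  embeds-mono : ∀ {k} {h : Fin k → Fin k → Bool} {S T f} → S ⊆ T → Embeds h S f → Embeds h T f
  embeds-mono S⊆T e = embedding (injective e) (λ i → S⊆T _ (inside e i)) (preserves e)

  KSFree : VSet N → ℕ → Set
  KSFree S m = ¬ Σ (Fin (m + m) → Fin N) (Embeds (KSAdj m) S)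

  ksFree-mono : ∀ {S T} m → T ⊆ S → KSFree S m → KSFree T m
  ksFree-mono _ T⊆S free (f , e) = free (f , embeds-mono T⊆S e)

  CliqueFree : VSet N → ℕ → Set
  CliqueFree S k = ∀ (f : Fin k → Fin N) → IsClique G f → ¬ (∀ i → f i ∈ S)

  cliqueFree-mono : ∀ {S T k} → T ⊆ S → CliqueFree S k → CliqueFree T k
  cliqueFree-mono T⊆S free f clique inT = free f clique (λ i → T⊆S _ (inT i))

  single-vertex-clique : ∀ x → IsClique G (λ (_ : Fin 1) → x)
  single-vertex-clique x = (λ { {zero} {zero} _ → refl }) , λ { zero zero 0≢0 → ⊥-elim (0≢0 refl) }

  clique-cons : ∀ {k} {f : Fin k → Fin N} v → IsClique G f → (∀ i → f i ∈ A v) → IsClique G (v ∷ f)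
  clique-cons {f = f} v (f-injective , f-adjacent) v-adjacent = injective′ , adjacent′
    where
    injective′ : Injective _≡_ _≡_ (v ∷ f)
    injective′ {zero}  {zero}  _ = refl
    injective′ {zero}  {suc j} e = ⊥-elim (adjacent⇒distinct (v-adjacent j) e)
    injective′ {suc i} {zero}  e = ⊥-elim (adjacent⇒distinct (v-adjacent i) (sym e))
    injective′ {suc i} {suc j} e = cong suc (f-injective e)
    adjacent′ : ∀ i j → i ≢ j → (v ∷ f) j ∈ A ((v ∷ f) i)
    adjacent′ zero    zero    i≢j = ⊥-elim (i≢j refl)
    adjacent′ zero    (suc j) _   = v-adjacent j
    adjacent′ (suc i) zero    _   = adj-sym (v-adjacent i)
    adjacent′ (suc i) (suc j) i≢j = f-adjacent i j (i≢j ∘ cong suc)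

  edge-is-KS₁ : ∀ {S x y} → x ∈ S → y ∈ S → y ∈ A x → Embeds (KSAdj 1) S (x ∷ y ∷ [])
  edge-is-KS₁ {S} {x} {y} x∈S y∈S xy = embedding injective′ inside′ preserves′
    where
    injective′ : Injective _≡_ _≡_ (x ∷ y ∷ [])
    injective′ {zero}     {zero}     _ = refl
    injective′ {zero}     {suc zero} e = ⊥-elim (adjacent⇒distinct xy e)
    injective′ {suc zero} {zero}     e = ⊥-elim (adjacent⇒distinct xy (sym e))
    injective′ {suc zero} {suc zero} _ = refl
    inside′ : ∀ i → (x ∷ y ∷ []) i ∈ S
    inside′ zero       = x∈S
    inside′ (suc zero) = y∈S
    preserves′ : ∀ i j → A ((x ∷ y ∷ []) i) ((x ∷ y ∷ []) j) ≡ KSAdj 1 i j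
    preserves′ zero       zero       = Graph.irrefl G x
    preserves′ zero       (suc zero) = xy
    preserves′ (suc zero) zero       = adj-sym xy
    preserves′ (suc zero) (suc zero) = Graph.irrefl G y

  record Pendant (S T : VSet N) (a b : Fin N) : Set where
    field
      a∈S    : a ∈ S
      b∈S    : b ∈ S
      ab     : b ∈ A a
      T⊆S    : T ⊆ S
      T⊆N[a] : T ⊆ A a
      b∉T    : ∀ y → y ∈ T → b ≢ y
      T∩N[b] : ∀ y → y ∈ T → y ∉ A b

  -- Extending K_s ▷ S_s: if T hangs below the edge ab, a copy of K_s ▷ S_s in T
  -- becomes a copy of K_{s+1} ▷ S_{s+1} in S with a as the last clique vertex
  -- (adjacent to everything) and b as the last stable vertex (adjacent to a only).
  module KSExtension {S T a b} (P : Pendant S T a b) {s} {f : Fin (s + s) → Fin N}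
                     (f-embeds : Embeds (KSAdj s) T f) where
    open Pendant P
    open Embeds f-embeds renaming (injective to f-injective; inside to f-inside; preserves to f-preserves)

    clique stable : ∀ {i : Fin (suc s)} → LastOrOld i → Fin N
    clique last    = a
    clique (old i) = f (i ↑ˡ s)
    stable last    = b
    stable (old i) = f (s ↑ʳ i)

    g : Fin (suc s + suc s) → Fin N
    g x with splitAt (suc s) x
    ... | inj₁ i = clique (lastOrOld i)
    ... | inj₂ j = stable (lastOrOld j)

    a∉T : ∀ y → y ∈ T → a ≢ y
    a∉T y y∈T = adjacent⇒distinct (T⊆N[a] y y∈T)

    ≤?-true : ∀ {p q} → p ≤ q → ⌊ p ≤? q ⌋ ≡ true
    ≤?-true = isYes-true (_ ≤? _)

    ≤?-false : ∀ {p q} → q < p → ⌊ p ≤? q ⌋ ≡ false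
    ≤?-false q<p = isYes-false (_ ≤? _) (<⇒≱ q<p)

    ≟-inject₁ : ∀ {m} (i j : Fin m) → ⌊ inject₁ i ≟ inject₁ j ⌋ ≡ ⌊ i ≟ j ⌋
    ≟-inject₁ i j = bool-ext (λ e → isYes-true (i ≟ j) (inject₁-injective (isYes-sound _ e)))
                             (λ e → isYes-true (inject₁ i ≟ inject₁ j) (cong inject₁ (isYes-sound _ e)))

    clique-clique : ∀ {i j : Fin (suc s)} (vi : LastOrOld i) (vj : LastOrOld j) →
      A (clique vi) (clique vj) ≡ not ⌊ i ≟ j ⌋
    clique-clique last last rewrite isYes-true (fromℕ s ≟ fromℕ s) refl = Graph.irrefl G a
    clique-clique last (old j) rewrite isYes-false (fromℕ s ≟ inject₁ j) fromℕ≢inject₁ = T⊆N[a] _ (f-inside _)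
    clique-clique (old i) last rewrite isYes-false (inject₁ i ≟ fromℕ s) (fromℕ≢inject₁ ∘ sym) =
      adj-sym (T⊆N[a] _ (f-inside _))
    clique-clique (old i) (old j) rewrite ≟-inject₁ i j = trans (f-preserves _ _) (KSAdj-clique s i j)

    clique-stable : ∀ {i j : Fin (suc s)} (vi : LastOrOld i) (vj : LastOrOld j) →
      A (clique vi) (stable vj) ≡ ⌊ toℕ j ≤? toℕ i ⌋
    clique-stable last last rewrite ≤?-true (≤-refl {toℕ (fromℕ s)}) = ab
    clique-stable last (old j)
      rewrite ≤?-true (subst₂ _≤_ (sym (toℕ-inject₁ j)) (sym (toℕ-fromℕ s)) (<⇒≤ (toℕ<n j))) =
      T⊆N[a] _ (f-inside _)
    clique-stable (old i) last
      rewrite ≤?-false (subst₂ _<_ (sym (toℕ-inject₁ i)) (sym (toℕ-fromℕ s)) (toℕ<n i)) =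
      trans (Graph.sym G _ b) (T∩N[b] _ (f-inside _))
    clique-stable (old i) (old j) rewrite toℕ-inject₁ i | toℕ-inject₁ j =
      trans (f-preserves _ _) (KSAdj-cross s i j)

    stable-stable : ∀ {i j : Fin (suc s)} (vi : LastOrOld i) (vj : LastOrOld j) → A (stable vi) (stable vj) ≡ false
    stable-stable last    last    = Graph.irrefl G b
    stable-stable last    (old j) = T∩N[b] _ (f-inside _)
    stable-stable (old i) last    = trans (Graph.sym G _ b) (T∩N[b] _ (f-inside _))
    stable-stable (old i) (old j) = trans (f-preserves _ _) (KSAdj-stable s i j)

    g-preserves : ∀ x y → A (g x) (g y) ≡ KSAdj (suc s) x y
    g-preserves x y with splitAt (suc s) x | splitAt (suc s) y
    ... | inj₁ i | inj₁ j = clique-clique (lastOrOld i) (lastOrOld j)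
    ... | inj₁ i | inj₂ j = clique-stable (lastOrOld i) (lastOrOld j)
    ... | inj₂ j | inj₁ i = trans (Graph.sym G _ _) (clique-stable (lastOrOld i) (lastOrOld j))
    ... | inj₂ i | inj₂ j = stable-stable (lastOrOld i) (lastOrOld j)

    clique≢stable-old : ∀ (i j : Fin s) → i ↑ˡ s ≢ s ↑ʳ j
    clique≢stable-old i j e = <⇒≢ (≤-trans (subst (_< s) (sym (toℕ-↑ˡ i s)) (toℕ<n i))
                                            (subst (s ≤_) (sym (toℕ-↑ʳ s j)) (m≤m+n s (toℕ j)))) (cong toℕ e)

    clique-injective : ∀ {i j : Fin (suc s)} (vi : LastOrOld i) (vj : LastOrOld j) → clique vi ≡ clique vj → i ≡ j
    clique-injective last    last    _ = refl
    clique-injective last    (old j) e = ⊥-elim (a∉T _ (f-inside _) e)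
    clique-injective (old i) last    e = ⊥-elim (a∉T _ (f-inside _) (sym e))
    clique-injective (old i) (old j) e = cong inject₁ (↑ˡ-injective s i j (f-injective e))

    stable-injective : ∀ {i j : Fin (suc s)} (vi : LastOrOld i) (vj : LastOrOld j) → stable vi ≡ stable vj → i ≡ j
    stable-injective last    last    _ = refl
    stable-injective last    (old j) e = ⊥-elim (b∉T _ (f-inside _) e)
    stable-injective (old i) last    e = ⊥-elim (b∉T _ (f-inside _) (sym e))
    stable-injective (old i) (old j) e = cong inject₁ (↑ʳ-injective s i j (f-injective e))

    clique≢stable : ∀ {i j : Fin (suc s)} (vi : LastOrOld i) (vj : LastOrOld j) → clique vi ≢ stable vj
    clique≢stable last    last    e = adjacent⇒distinct ab e
    clique≢stable last    (old j) e = a∉T _ (f-inside _) e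
    clique≢stable (old i) last    e = b∉T _ (f-inside _) (sym e)
    clique≢stable (old i) (old j) e = clique≢stable-old i j (f-injective e)

    g-injective : Injective _≡_ _≡_ g
    g-injective {x} {y} e = trans (sym (join-splitAt (suc s) (suc s) x))
      (trans (cong (join (suc s) (suc s)) (same-side x y e)) (join-splitAt (suc s) (suc s) y))
      where
      same-side : ∀ x y → g x ≡ g y → splitAt (suc s) x ≡ splitAt (suc s) y
      same-side x y with splitAt (suc s) x | splitAt (suc s) y
      ... | inj₁ i | inj₁ j = λ e → cong inj₁ (clique-injective (lastOrOld i) (lastOrOld j) e)
      ... | inj₁ i | inj₂ j = λ e → ⊥-elim (clique≢stable (lastOrOld i) (lastOrOld j) e)
      ... | inj₂ j | inj₁ i = λ e → ⊥-elim (clique≢stable (lastOrOld i) (lastOrOld j) (sym e))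
      ... | inj₂ i | inj₂ j = λ e → cong inj₂ (stable-injective (lastOrOld i) (lastOrOld j) e)

    g-inside : ∀ x → g x ∈ S
    g-inside x with splitAt (suc s) x
    ... | inj₁ i = clique-inside (lastOrOld i)
      where
      clique-inside : ∀ {i : Fin (suc s)} (vi : LastOrOld i) → clique vi ∈ S
      clique-inside last    = a∈S
      clique-inside (old i) = T⊆S _ (f-inside _)
    ... | inj₂ j = stable-inside (lastOrOld j)
      where
      stable-inside : ∀ {j : Fin (suc s)} (vj : LastOrOld j) → stable vj ∈ S
      stable-inside last    = b∈S
      stable-inside (old j) = T⊆S _ (f-inside _)

    g-embeds : Embeds (KSAdj (suc s)) S g
    g-embeds = embedding g-injective g-inside g-preserves

  ks-extend : ∀ {S T a b s} → Pendant S T a b → KSFree S (suc s) → KSFree T s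
  ks-extend {s = s} P free (f , f-embeds) = free (g , g-embeds)
    where open KSExtension P {s} f-embeds

  -- Colouring along induced paths (Gyárfás' argument), inside a fixed set S.
  -- A path q is stored tip first: head q is the end that is being extended.
  module InducedPaths (S : VSet N) where

    InducedPath : ∀ {L} → Vector (Fin N) L → Set
    InducedPath {L} = Embeds (pathAdj L) S

    touches : ∀ {k} → Vector (Fin N) (suc k) → VSet N
    touches q y = exists (λ i → (⟦ q (suc i) ⟧ ∪ A (q (suc i))) y)

    -- live q: the vertices of S that may still follow the tip of q.
    live : ∀ {k} → Vector (Fin N) (suc k) → VSet N
    live q = S ∖ touches q

    ahead : ∀ {k} → Vector (Fin N) (suc k) → VSet N
    ahead q = reach (live q) (head q) ∖ ⟦ head q ⟧

    extensions : ∀ {k} → Vector (Fin N) (suc k) → VSet N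
    extensions q = live q ∩ A (head q)

    -- region q u: the vertices ahead of u ∷ q, if u extends q (empty otherwise).
    region : ∀ {k} → Vector (Fin N) (suc k) → Fin N → VSet N
    region q u = (λ _ → extensions q u) ∩ ahead (u ∷ q)

    live-avoids : ∀ {k} (q : Vector (Fin N) (suc k)) {y} → y ∈ live q → ∀ i → q (suc i) ≢ y × y ∉ A (q (suc i))
    live-avoids q {y} y∈ i with ∉∪⁻ (exists-none (λ i → (⟦ q (suc i) ⟧ ∪ A (q (suc i))) y) (∖⁻ʳ y∈) i)
    ... | y∉⟦⟧ , y∉A = ∉⟦⟧⁻ y∉⟦⟧ , y∉A

    live-extend : ∀ {k} (q : Vector (Fin N) (suc k)) {y} u →
      y ∈ live q → y ∉ ⟦ head q ⟧ → y ∉ A (head q) → y ∈ live (u ∷ q)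
    live-extend q {y} u y∈ y∉tip y∉A = ∖⁺ (∖⁻ˡ y∈) untouched
      where
      -- touches (u ∷ q) y unfolds to (⟦ head q ⟧ ∪ A (head q)) y ∨ touches q y.
      untouched : y ∉ touches (u ∷ q)
      untouched = subst₂ (λ b c → b ∨ c ≡ false) (sym (∉∪⁺ y∉tip y∉A)) (sym (∖⁻ʳ y∈)) refl

    ahead-live : ∀ {k} (q : Vector (Fin N) (suc k)) {y} → y ∈ ahead q → y ∈ live q
    ahead-live q y∈ with ball-⊆ N (∖⁻ˡ y∈)
    ... | inj₁ tip≡y = ⊥-elim (∉⟦⟧⁻ (∖⁻ʳ y∈) tip≡y)
    ... | inj₂ y∈live = y∈live

    extend-path : ∀ {k} {q : Vector (Fin N) (suc k)} {u} → InducedPath q → u ∈ extensions q → InducedPath (u ∷ q)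
    extend-path {q = q} {u} path u∈ext = embedding injective′ inside′ preserves′
      where
      open Embeds path renaming (injective to q-injective; inside to q-inside; preserves to q-preserves)
      u∈live : u ∈ live q
      u∈live = ∩⁻ˡ u∈ext
      tip-u : u ∈ A (q zero)
      tip-u = ∩⁻ʳ u∈ext
      fresh : ∀ i → u ≢ q i
      fresh zero    e = adjacent⇒distinct tip-u (sym e)
      fresh (suc i) e = proj₁ (live-avoids q u∈live i) (sym e)
      injective′ : Injective _≡_ _≡_ (u ∷ q)
      injective′ {zero}  {zero}  _ = refl
      injective′ {zero}  {suc j} e = ⊥-elim (fresh j e)
      injective′ {suc i} {zero}  e = ⊥-elim (fresh i (sym e))
      injective′ {suc i} {suc j} e = cong suc (q-injective e)
      inside′ : ∀ i → (u ∷ q) i ∈ S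
      inside′ zero    = ∖⁻ˡ u∈live
      inside′ (suc i) = q-inside i
      preserves′ : ∀ i j → A ((u ∷ q) i) ((u ∷ q) j) ≡ diff1 (toℕ i) (toℕ j)
      preserves′ zero          zero          = Graph.irrefl G u
      preserves′ zero          (suc zero)    = adj-sym tip-u
      preserves′ zero          (suc (suc j)) = trans (Graph.sym G u _) (proj₂ (live-avoids q u∈live j))
      preserves′ (suc zero)    zero          = tip-u
      preserves′ (suc (suc i)) zero          = proj₂ (live-avoids q u∈live i)
      preserves′ (suc i)       (suc j)       = trans (q-preserves i j) (sym (diff1-suc (toℕ i) (toℕ j)))

    ball-splits : ∀ {k} (q : Vector (Fin N) (suc k)) j {y} → y ∈ ball (live q) (head q) j →
      head q ≡ y ⊎ y ∈ A (head q) ⊎ ∃ λ u → u ∈ extensions q × y ∈ reach (live (u ∷ q)) u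
    ball-splits q zero    y∈ = inj₁ (∈⟦⟧ y∈)
    ball-splits q (suc j) {y} y∈ with ∪⁻ y∈
    ... | inj₁ earlier = ball-splits q j earlier
    ... | inj₂ new with ∈-or-∉ y ⟦ head q ⟧ | ∈-or-∉ y (A (head q))
    ...   | inj₁ y∈tip | _        = inj₁ (∈⟦⟧ y∈tip)
    ...   | inj₂ _     | inj₁ y∈A = inj₂ (inj₁ y∈A)
    ...   | inj₂ y∉tip | inj₂ y∉A with nbhd⁻ (∩⁻ʳ new)
    ...     | z , z∈ball , zy = inj₂ (inj₂ (through (ball-splits q j z∈ball)))
      where
      y-live : ∀ u → y ∈ live (u ∷ q)
      y-live u = live-extend q u (∩⁻ˡ new) y∉tip y∉A
      through : head q ≡ z ⊎ z ∈ A (head q) ⊎ (∃ λ u → u ∈ extensions q × z ∈ reach (live (u ∷ q)) u) →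
                ∃ λ u → u ∈ extensions q × y ∈ reach (live (u ∷ q)) u
      through (inj₁ tip≡z) = ⊥-elim (bool-clash (subst (λ t → y ∈ A t) (sym tip≡z) zy) y∉A)
      through (inj₂ (inj₁ z∈A)) with ball-⊆ j z∈ball
      ... | inj₁ tip≡z  = ⊥-elim (adjacent⇒distinct z∈A tip≡z)
      ... | inj₂ z∈live = z , ∩⁺ z∈live z∈A , reach-closed _ z z y (ball-centre _ z N) (y-live z) zy
      through (inj₂ (inj₂ (u , u∈ext , z∈reach))) = u , u∈ext , reach-closed _ u z y z∈reach (y-live u) zy

    ahead-routed : ∀ {k} (q : Vector (Fin N) (suc k)) {y} → y ∈ ahead q → y ∉ A (head q) → ∃ λ u → y ∈ region q u
    ahead-routed q y∈ y∉A with ball-splits q N (∖⁻ˡ y∈)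
    ... | inj₁ tip≡y = ⊥-elim (∉⟦⟧⁻ (∖⁻ʳ y∈) tip≡y)
    ... | inj₂ (inj₁ y∈A) = ⊥-elim (bool-clash y∈A y∉A)
    ... | inj₂ (inj₂ (u , u∈ext , y∈reach)) = u , ∩⁺ u∈ext (∖⁺ y∈reach (separated-by (∩⁻ʳ u∈ext) y∉A))

    ahead-extendable : ∀ {k} (q : Vector (Fin N) (suc k)) {y} → y ∈ ahead q → ∃ λ u → u ∈ extensions q
    ahead-extendable q {y} y∈ with ∈-or-∉ y (A (head q))
    ... | inj₁ y∈A = y , ∩⁺ (ahead-live q y∈) y∈A
    ... | inj₂ y∉A with ahead-routed q y∈ y∉A
    ...   | u , y∈region = u , ∩⁻ˡ y∈region

    region-step : ∀ {k} (q : Vector (Fin N) (suc k)) {y y′ u} →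
      y′ ∈ ahead q → y′ ∉ A (head q) → y′ ∈ A y → y ∈ region q u → y′ ∈ region q u
    region-step q {y} {y′} {u} y′∈ y′∉A yy′ y∈ = ∩⁺ u∈ext (∖⁺ y′∈reach (separated-by (∩⁻ʳ u∈ext) y′∉A))
      where
      u∈ext : u ∈ extensions q
      u∈ext = ∩⁻ˡ y∈
      y′∈reach : y′ ∈ reach (live (u ∷ q)) u
      y′∈reach = reach-closed _ u y y′ (∖⁻ˡ (∩⁻ʳ y∈)) (live-extend q u (ahead-live q y′∈) (∖⁻ʳ y′∈) y′∉A) yy′

    region-cong : ∀ {k} (q : Vector (Fin N) (suc k)) {y y′} →
      y ∈ ahead q ∖ A (head q) → y′ ∈ ahead q ∖ A (head q) → y′ ∈ A y → ∀ u → region q u y ≡ region q u y′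
    region-cong q y∈ y′∈ yy′ u = bool-ext (region-step q (∖⁻ˡ y′∈) (∖⁻ʳ y′∈) yy′)
                                         (region-step q (∖⁻ˡ y∈) (∖⁻ʳ y∈) (adj-sym yy′))

    -- The vertices ahead of q and not adjacent to its tip are coloured through
    -- their first region; adjacent such vertices share it, so one palette suffices.
    colour-far : ∀ {k} (q : Vector (Fin N) (suc k)) {c} → (∀ u → Colouring (region q u) c) →
      Colouring (ahead q ∖ A (head q)) c
    colour-far q {c} χ = colouring col bnd prp
      where
      route : Fin N → Maybe (Fin N)
      route y = first (λ u → region q u y)
      colour-via : Fin N → Maybe (Fin N) → ℕ
      colour-via y nothing  = 0
      colour-via y (just u) = colour (χ u) y
      col : Fin N → ℕ
      col y = colour-via y (route y)
      routed : ∀ {y} → y ∈ ahead q ∖ A (head q) → ∃ λ u → route y ≡ just u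
      routed y∈ with ahead-routed q (∖⁻ˡ y∈) (∖⁻ʳ y∈)
      ... | u , y∈region = first-complete _ u y∈region
      bnd : ∀ y → y ∈ ahead q ∖ A (head q) → col y < c
      bnd y y∈ with routed y∈
      ... | u , e rewrite e = bounded (χ u) y (first-sound _ e)
      prp : ∀ y y′ → y ∈ ahead q ∖ A (head q) → y′ ∈ ahead q ∖ A (head q) → y′ ∈ A y → col y ≢ col y′
      prp y y′ y∈ y′∈ yy′ with routed y∈
      ... | u , e with trans (sym (first-cong (region-cong q y∈ y′∈ yy′))) e
      ...   | e′ rewrite e | e′ = proper (χ u) y y′ (first-sound _ e) (first-sound _ e′) yy′

    colour-regions : ∀ {k} (q : Vector (Fin N) (suc k)) {c} →
      (∀ u → u ∈ extensions q → Colouring (ahead (u ∷ q)) c) → ∀ u → Colouring (region q u) c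
    colour-regions q χ u with ∈-or-∉ u (extensions q)
    ... | inj₁ u∈ext = colour-restrict (λ _ → ∩⁻ʳ) (χ u u∈ext)
    ... | inj₂ u∉ext = colour-empty λ y y∈ → bool-clash (∩⁻ˡ y∈) u∉ext

    pendant-at-tip : ∀ {k} {q : Vector (Fin N) (suc (suc k))} → InducedPath q →
      Pendant S (ahead q ∩ A (head q)) (q zero) (q (suc zero))
    pendant-at-tip {q = q} path = record
      { a∈S = q-inside zero ; b∈S = q-inside (suc zero) ; ab = q-preserves zero (suc zero)
      ; T⊆S = λ y y∈ → ∖⁻ˡ (ahead-live q (∩⁻ˡ y∈))
      ; T⊆N[a] = λ _ → ∩⁻ʳ
      ; b∉T = λ y y∈ → proj₁ (live-avoids q (ahead-live q (∩⁻ˡ y∈)) zero)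
      ; T∩N[b] = λ y y∈ → proj₂ (live-avoids q (ahead-live q (∩⁻ˡ y∈)) zero)
      }
      where open Embeds path renaming (inside to q-inside; preserves to q-preserves)

    -- Without induced P_n, and with every pendant set f-colourable, the part
    -- ahead of an induced path with ℓ vertices, ℓ + 1 + d = n, takes d · f
    -- colours: each extension of the path costs one pendant palette, and an
    -- extension to n vertices would be an induced P_n.
    module ColourAhead (n : ℕ) (no-Pₙ : ¬ HasInduced (pathAdj n) G) (f : ℕ)
                       (colour-pendant : ∀ {T a b} → Pendant S T a b → Colouring T f) where

      colour-ahead : ∀ d {k} (q : Vector (Fin N) (suc (suc k))) → InducedPath q →
        d + suc (suc (suc k)) ≡ n → Colouring (ahead q) (d * f)
      colour-ahead zero q path len = colour-empty λ y y∈ → too-long (ahead-extendable q y∈)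
        where
        too-long : (∃ λ u → u ∈ extensions q) → ⊥
        too-long (u , u∈ext) = no-Pₙ (subst (λ L → HasInduced (pathAdj L) G) len (induced-in-G (extend-path path u∈ext)))
      colour-ahead (suc d) q path len =
        colour-split (A (head q)) (colour-pendant (pendant-at-tip path))
          (colour-far q (colour-regions q λ u u∈ext →
            colour-ahead d (u ∷ q) (extend-path path u∈ext) (trans (+-suc d _) len)))

  module ChromaticBound (n : ℕ) (n≥4 : 4 ≤ n) (no-Pₙ : ¬ HasInduced (pathAdj n) G) where

    a : ℕ
    a = n ∸ 3

    -- The induction step for one component: given the colourings for
    -- (s + 1, w) and (s, w + 1), the component K of v in G[S] is coloured by
    -- splitting it into the neighbours of v and the rest.
    colour-component : ∀ {s w} →
      (∀ S → KSFree S (suc (suc s)) → CliqueFree S (suc w) → Colouring S (bound a (suc s) w)) →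
      (∀ S → KSFree S (suc s) → CliqueFree S (suc (suc w)) → Colouring S (bound a s (suc w))) →
      ∀ S → KSFree S (suc (suc s)) → CliqueFree S (suc (suc w)) → ∀ v → v ∈ S →
      Σ (VSet N) λ K → v ∈ K × Anticomplete (S ∩ K) (S ∖ K) × Colouring (S ∩ K) (bound a (suc s) (suc w))
    colour-component {s} {w} colour-fewer-cliques colour-smaller-KS S ks-free clique-free v v∈S =
      K , ball-centre _ v N , apart , colour-restrict (λ _ → ∩⁻ʳ) colour-K
      where
      open InducedPaths S
      open ColourAhead n no-Pₙ (bound a s (suc w))
        (λ P → colour-smaller-KS _ (ks-extend P ks-free) (cliqueFree-mono (Pendant.T⊆S P) clique-free))

      tip : Vector (Fin N) 1
      tip = v ∷ []

      tip-path : InducedPath tip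
      tip-path = embedding (λ { {zero} {zero} _ → refl }) (λ { zero → v∈S }) (λ { zero zero → Graph.irrefl G v })

      K : VSet N
      K = reach (live tip) v

      -- K is closed under S-neighbours, so no edge leaves it inside S.
      apart : Anticomplete (S ∩ K) (S ∖ K)
      apart x y x∈ y∈ xy =
        bool-clash (reach-closed (live tip) v x y (∩⁻ʳ x∈) (∖⁺ (∖⁻ˡ y∈) refl) xy) (∖⁻ʳ y∈)

      -- The neighbours of v in K: v extends each of their cliques.
      near⊆S : K ∩ A v ⊆ S
      near⊆S y y∈ with ball-⊆ N (∩⁻ˡ y∈)
      ... | inj₁ v≡y    = ⊥-elim (adjacent⇒distinct (∩⁻ʳ y∈) v≡y)
      ... | inj₂ y∈live = ∖⁻ˡ y∈live

      near-clique-free : CliqueFree (K ∩ A v) (suc w)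
      near-clique-free f f-clique f-near =
        clique-free (v ∷ f) (clique-cons v f-clique (λ i → ∩⁻ʳ (f-near i))) with-v
        where
        with-v : ∀ i → (v ∷ f) i ∈ S
        with-v zero    = v∈S
        with-v (suc i) = near⊆S _ (f-near i)

      colour-near : Colouring (K ∩ A v) (bound a (suc s) w)
      colour-near = colour-fewer-cliques _ (ksFree-mono (suc (suc s)) near⊆S ks-free) near-clique-free

      -- The rest of K: v itself, and the vertices ahead of the one-vertex path v
      -- that are not adjacent to v, which need at most n - 3 path extensions.
      colour-far-part : Colouring (ahead tip ∖ A v) (a * bound a s (suc w))
      colour-far-part = colour-far tip (colour-regions tip λ u u∈ext →
        colour-ahead a (u ∷ tip) (extend-path tip-path u∈ext) (m∸n+n≡m (≤-trans (s≤s (s≤s (s≤s z≤n))) n≥4)))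

      v-isolated : Anticomplete ((K ∖ A v) ∩ ⟦ v ⟧) ((K ∖ A v) ∖ ⟦ v ⟧)
      v-isolated x y x∈ y∈ xy = bool-clash (subst (λ t → y ∈ A t) (sym (∈⟦⟧ (∩⁻ʳ x∈))) xy) (∖⁻ʳ (∖⁻ˡ y∈))

      rest⊆far : (K ∖ A v) ∖ ⟦ v ⟧ ⊆ ahead tip ∖ A v
      rest⊆far y y∈ = ∖⁺ (∖⁺ (∖⁻ˡ (∖⁻ˡ y∈)) (∖⁻ʳ y∈)) (∖⁻ʳ (∖⁻ˡ y∈))

      colour-rest : Colouring (K ∖ A v) (a * bound a s (suc w))
      colour-rest = colour-glue ⟦ v ⟧ v-isolated
        (colour-restrict (λ _ → ∩⁻ʳ) (colour-singleton v (bound-pos s w (∸-monoˡ-≤ 3 n≥4))))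
        (colour-restrict rest⊆far colour-far-part)

      colour-K : Colouring K (bound a (suc s) (suc w))
      colour-K = colour-weaken (bound-step a s w) (colour-split (A v) colour-near colour-rest)

    colour-set : ∀ s w S → KSFree S (suc s) → CliqueFree S (suc w) → Colouring S (bound a s w)
    colour-set zero w S ks-free _ =
      colouring (λ _ → 0) (λ _ _ → s≤s z≤n) λ x y x∈S y∈S xy _ → ks-free (x ∷ y ∷ [] , edge-is-KS₁ x∈S y∈S xy)
    colour-set (suc s) zero S _ clique-free =
      colour-empty λ x x∈S → clique-free (λ _ → x) (single-vertex-clique x) (λ _ → x∈S)
    colour-set (suc s) (suc w) S ks-free clique-free = colour-by-pieces λ S′ S′⊆S →
      colour-component (colour-set (suc s) w) (colour-set s (suc w))
        S′ (ksFree-mono (suc (suc s)) S′⊆S ks-free) (cliqueFree-mono S′⊆S clique-free)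

theorem1p5 : (n : ℕ) → 4 ≤ n → ∀ {N} (G : Graph N) (w : ℕ) →
    ¬ HasInduced (pathAdj n) G →
    ¬ HasInduced (KSAdj (ceilHalf n)) G →
    IsCliqueNumber G w →
    ChromaticAtMost G (((n ∸ 3) ^ (ceilHalf n ∸ 1)) * (w ^ (ceilHalf n ∸ 1)))
theorem1p5 n n≥4 G w no-Pₙ no-KS (_ , no-larger-clique) =
  chromatic-from-colouring G (colour-set (ceilHalf n ∸ 1) w everything ks-free clique-free)
  where
  open ChromaticBound G n n≥4 no-Pₙ

  -- ⌈n/2⌉ ≥ 1, so ⌈n/2⌉ = (⌈n/2⌉ - 1) + 1.
  ceilHalf-pos : 1 ≤ ceilHalf n
  ceilHalf-pos = m≥n⇒m/n>0 (≤-trans (s≤s (s≤s z≤n)) (≤-trans n≥4 (m≤m+n n 1)))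

  ks-free : KSFree G everything (suc (ceilHalf n ∸ 1))
  ks-free = subst (KSFree G everything) (sym (m+[n∸m]≡n ceilHalf-pos)) λ (f , e) → no-KS (induced-in-G G e)

  clique-free : CliqueFree G everything (suc w)
  clique-free f f-clique _ = no-larger-clique (suc w) ≤-refl (f , f-clique)
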